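{- For every integer $n\geq 2$, $\gamma_2(G_{2,n})=n$ and $b_2(G_{2,n})=1$.
   Context: For a graph $G$, a set $D\subseteq V(G)$ is a $2$-dominating set if every vertex not in $D$ has at least $2$ neighbours in $D$. The $2$-domination number $\gamma_2(G)$ is the minimum cardinality of a $2$-dominating set of $G$. The $2$-bondage number $b_2(G)$ is the minimum cardinality of an edge set $B\subseteq E(G)$ such that $\gamma_2(G-B)>\gamma_2(G)$, where $G-B$ has vertex set $V(G)$ and edge set $E(G)\setminus B$. The grid graph $G_{m,n}=P_m\times P_n$ has vertex set $[m]\times[n]$ (where $[k]=\{1,\dots,k\}$), with $(i,j)$ and $(i',j')$ adjacent iff $|i-i'|+|j-j'|=1$. -}

module Defs where

open import Data.Bool using (Bool; true; false; _∧_; _∨_; not; if_then_else_)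
open import Data.Nat using (ℕ; _+_; _*_; _≤_; _<_; ∣_-_∣; _≡ᵇ_; _<ᵇ_)
open import Data.Fin using (Fin; toℕ; remQuot)
open import Data.Fin.Subset using (Subset; _∉_; _∩_; ∣_∣)
open import Data.Vec using (tabulate)
open import Data.Nat.ListAction using (sum)
open import Data.List using (List; map; concatMap; allFin)
open import Data.Product using (_×_; _,_; ∃; Σ-syntax)
open import Relation.Binary.PropositionalEquality using (_≡_)

-- A graph on vertex set Fin v, given by its Boolean adjacency function
-- (the graphs used here are symmetric and loopless by construction).
Graph : ℕ → Set
Graph v = Fin v → Fin v → Bool

adj : ∀ {v} → Graph v → Fin v → Fin v → Bool
adj G = G

N : ∀ {v} → Graph v → Fin v → Subset v
N G x = tabulate (adj G x)

Is2Dominating : ∀ {v} → Graph v → Subset v → Set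
Is2Dominating G D = ∀ x → x ∉ D → 2 ≤ ∣ N G x ∩ D ∣

γ₂≡ : ∀ {v} → Graph v → ℕ → Set
γ₂≡ G k = (Σ[ D ∈ Subset _ ] (Is2Dominating G D × ∣ D ∣ ≡ k))
        × (∀ D → Is2Dominating G D → k ≤ ∣ D ∣)

-- An edge set B ⊆ E(G) is represented by a Boolean function on ordered
-- pairs; the unordered edge {x,y} belongs to B iff adj x y and (B x y or B y x).
EdgeSet : ℕ → Set
EdgeSet v = Fin v → Fin v → Bool

inB : ∀ {v} → Graph v → EdgeSet v → Fin v → Fin v → Bool
inB G B x y = adj G x y ∧ (B x y ∨ B y x)

_─_ : ∀ {v} → Graph v → EdgeSet v → Graph v
_─_ G B x y = adj G x y ∧ not (B x y ∨ B y x)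

∣_∣ₑ[_] : ∀ {v} → EdgeSet v → Graph v → ℕ
∣_∣ₑ[_] {v} B G =
  sum (concatMap (λ x → map (λ y → if (toℕ x <ᵇ toℕ y) ∧ inB G B x y then 1 else 0)
                            (allFin v))
                 (allFin v))

Increases : ∀ {v} → Graph v → EdgeSet v → Set
Increases G B = ∀ k → γ₂≡ G k → ∀ D → Is2Dominating (G ─ B) D → k < ∣ D ∣

b₂≡ : ∀ {v} → Graph v → ℕ → Set
b₂≡ G b = (Σ[ B ∈ EdgeSet _ ] (Increases G B × ∣ B ∣ₑ[ G ] ≡ b))
        × (∀ B → Increases G B → b ≤ ∣ B ∣ₑ[ G ])

-- Grid graph G_{m,n} = P_m × P_n on Fin (m * n), vertex x ↦ (i , j) = remQuot n x
-- (0-based coordinates), adjacent iff |i-i'| + |j-j'| = 1.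
gridAdj : ∀ m n → Fin (m * n) → Fin (m * n) → Bool
gridAdj m n x y with remQuot {m} n x | remQuot {m} n y
... | (i , j) | (i' , j') = (∣ toℕ i - toℕ i' ∣ + ∣ toℕ j - toℕ j' ∣) ≡ᵇ 1

grid : ∀ m n → Graph (m * n)
grid = gridAdj

-- Write the ladder G_{2,n} column by column and let c_j ∈ {0,1,2} be the number of
-- vertices of a 2-dominating set D in column j. A vertex of an empty column has at
-- most its left and right neighbours in D, so it needs both: an empty column is
-- followed by a full one, and the last column is not empty. Pairing each empty
-- column with the full column after it gives ∣D∣ ≥ n, and the checkerboard
-- colouring attains n. Deleting the first rung leaves both corners of the first
-- column with a single neighbour, so they lie in every 2-dominating set of the
-- smaller graph; a full first column pushes the count to n + 1, hence b₂ = 1.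
module Submission where

open import Defs
open import Data.Bool using (Bool; true; false; _∧_; _∨_; not; if_then_else_; T)
open import Data.Bool.Properties using (T-≡; T-not-≡; T-∧; T-∨; ∨-comm; not-involutive)
open import Data.Empty using (⊥-elim)
open import Data.Fin using (Fin; zero; suc; toℕ; fromℕ; inject₁; opposite; combine; remQuot; _↑ˡ_; _↑ʳ_; _≟_)
open import Data.Fin.Properties
  using (toℕ-injective; toℕ<n; toℕ-fromℕ; toℕ-inject₁; suc-injective; 0≢1+n;
         remQuot-combine; combine-surjective; combine-injectiveˡ)
open import Data.Fin.Subset using (Subset; _∈_; _∉_; _∩_; _⊆_; ⁅_⁆; ∣_∣)
open import Data.Fin.Subset.Properties
  using (_∈?_; x∈p∩q⁺; x∈p∩q⁻; p⊆q⇒∣p∣≤∣q∣; p⊂q⇒∣p∣<∣q∣; ∣⁅x⁆∣≡1; x∈⁅y⁆⇒x≡y; x≢y⇒x∉⁅y⁆; Empty-unique; ∣⊥∣≡0)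
open import Data.List using (List; map; concatMap)
import Data.List as List
open import Data.Nat using (ℕ; zero; suc; _+_; _*_; _≤_; _<_; z≤n; s≤s; z<s; ∣_-_∣; _≡ᵇ_; _<ᵇ_)
open import Data.Nat.ListAction using () renaming (sum to sumᴸ)
open import Data.Nat.ListAction.Properties using (sum-++)
import Data.Nat.Properties as ℕ
open import Data.Nat.Properties
  using (+-0-commutativeMonoid; +-assoc; +-identityʳ; ≤-trans; ≤-reflexive; ≤-<-trans; m≤m+n; m≤n+m; +-mono-≤;
         n≤0⇒n≡0; <-irrefl; <-asym; <-cmp; ≡ᵇ⇒≡; <⇒<ᵇ; <ᵇ⇒<; ∣n-n∣≡0; ∣m-n∣≡0⇒m≡n; ∣-∣-comm)
open import Algebra.Properties.CommutativeMonoid.Sum +-0-commutativeMonoid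
  using (sum-syntax; sum-cong-≗; sum-replicate-zero; ∑-comm)
open import Data.Product using (_×_; _,_; proj₁; proj₂; ∃-syntax; Σ-syntax; uncurry)
open import Data.Sum using (_⊎_; inj₁; inj₂)
import Data.Sum as Sum
open import Data.Vec using ([]; _∷_; lookup; tabulate; here; there)
open import Data.Vec.Properties using (lookup∘tabulate; lookup⇒[]=; []=⇒lookup)
open import Function using (_∘_; id)
open import Function.Bundles using (Equivalence)
open import Relation.Binary using (tri<; tri≈; tri>)
open import Relation.Binary.PropositionalEquality
  using (_≡_; _≢_; refl; sym; trans; cong; cong₂; subst; module ≡-Reasoning)
open import Relation.Nullary using (¬_; yes; no; contradiction)
open import Relation.Nullary.Decidable using (⌊_⌋)

open Equivalence using (to; from)

𝟙 : Bool → ℕ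
𝟙 b = if b then 1 else 0

T⇒𝟙≡1 : ∀ {b} → T b → 𝟙 b ≡ 1
T⇒𝟙≡1 {true} _ = refl

¬T⇒𝟙≡0 : ∀ {b} → ¬ T b → 𝟙 b ≡ 0
¬T⇒𝟙≡0 {true} ¬t = contradiction _ ¬t
¬T⇒𝟙≡0 {false} _ = refl

¬T⇒T-not : ∀ {b} → ¬ T b → T (not b)
¬T⇒T-not {true} ¬t = ¬t _
¬T⇒T-not {false} _ = _

T-not⇒¬T : ∀ {b} → T (not b) → ¬ T b
T-not⇒¬T t = subst T (to T-not-≡ t)

∑-↑ : ∀ m {n} (f : Fin (m + n) → ℕ) →
      ∑[ x < m + n ] f x ≡ ∑[ i < m ] f (i ↑ˡ n) + ∑[ j < n ] f (m ↑ʳ j)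
∑-↑ zero f = refl
∑-↑ (suc m) f = trans (cong (f zero +_) (∑-↑ m (f ∘ suc))) (sym (+-assoc (f zero) _ _))

∑-combine : ∀ m {n} (f : Fin (m * n) → ℕ) →
            ∑[ x < m * n ] f x ≡ ∑[ i < m ] ∑[ j < n ] f (combine i j)
∑-combine zero f = refl
∑-combine (suc m) {n} f =
  trans (∑-↑ n f) (cong (∑[ j < n ] f (combine {suc m} zero j) +_) (∑-combine m {n} (λ x → f (n ↑ʳ x))))

∑-zero : ∀ {n} {f : Fin n → ℕ} → (∀ i → f i ≡ 0) → ∑[ i < n ] f i ≡ 0
∑-zero {n} f≡0 = trans (sum-cong-≗ f≡0) (sum-replicate-zero n)

∑-δ : ∀ {n} (f : Fin n → ℕ) i → (∀ j → j ≢ i → f j ≡ 0) → ∑[ j < n ] f j ≡ f i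
∑-δ f zero off = trans (cong (f zero +_) (∑-zero (λ j → off (suc j) λ ()))) (+-identityʳ (f zero))
∑-δ f (suc i) off = trans (cong (_+ ∑[ j < _ ] f (suc j)) (off zero λ ()))
                          (∑-δ (f ∘ suc) i (λ j j≢i → off (suc j) (j≢i ∘ suc-injective)))

≤-∑ : ∀ {n} (f : Fin n → ℕ) i → f i ≤ ∑[ j < n ] f j
≤-∑ f zero = m≤m+n (f zero) _
≤-∑ f (suc i) = ≤-trans (≤-∑ (f ∘ suc) i) (m≤n+m _ (f zero))

∑-1 : ∀ n → ∑[ i < n ] 1 ≡ n
∑-1 zero = refl
∑-1 (suc n) = cong suc (∑-1 n)

ZerosFollowedByTwos : ∀ {k} → (Fin (suc k) → ℕ) → Set
ZerosFollowedByTwos {k} c = ∀ (j : Fin k) → c (inject₁ j) ≡ 0 → c (suc j) ≡ 2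

-- Proved simultaneously: a leading 0 is paired with the 2 that follows it.
length≤∑ : ∀ {k} (c : Fin (suc k) → ℕ) → ZerosFollowedByTwos c → 1 ≤ c (fromℕ k) →
           suc k ≤ ∑[ j < suc k ] c j
length<∑ : ∀ {k} (c : Fin (suc k) → ℕ) → ZerosFollowedByTwos c → 1 ≤ c (fromℕ k) → 2 ≤ c zero →
           suc k < ∑[ j < suc k ] c j

length≤∑ {zero} c _ last = ≤-trans last (m≤m+n _ 0)
length≤∑ {suc k} c step last with c zero in c₀
... | zero = length<∑ (c ∘ suc) (step ∘ suc) last (≤-reflexive (sym (step zero c₀)))
... | suc m = s≤s (≤-trans (length≤∑ (c ∘ suc) (step ∘ suc) last) (m≤n+m _ m))

length<∑ {zero} c _ _ first = ≤-trans first (m≤m+n _ 0)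
length<∑ {suc k} c step last first = +-mono-≤ first (length≤∑ (c ∘ suc) (step ∘ suc) last)

sumᴸ-concatMap : ∀ {A : Set} (F : A → List ℕ) xs → sumᴸ (concatMap F xs) ≡ sumᴸ (map (sumᴸ ∘ F) xs)
sumᴸ-concatMap F List.[] = refl
sumᴸ-concatMap F (x List.∷ xs) = trans (sum-++ (F x) _) (cong (sumᴸ (F x) +_) (sumᴸ-concatMap F xs))

sumᴸ-map-tabulate : ∀ {A : Set} {n} (f : A → ℕ) (g : Fin n → A) →
                    sumᴸ (map f (List.tabulate g)) ≡ ∑[ i < n ] f (g i)
sumᴸ-map-tabulate {n = zero} f g = refl
sumᴸ-map-tabulate {n = suc n} f g = cong (f (g zero) +_) (sumᴸ-map-tabulate f (g ∘ suc))

∣p∣≡∑ : ∀ {n} (p : Subset n) → ∣ p ∣ ≡ ∑[ x < n ] 𝟙 (lookup p x)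
∣p∣≡∑ [] = refl
∣p∣≡∑ (true ∷ p) = cong suc (∣p∣≡∑ p)
∣p∣≡∑ (false ∷ p) = ∣p∣≡∑ p

∣p∣≡∑∑ : ∀ m {n} (p : Subset (m * n)) → ∣ p ∣ ≡ ∑[ j < n ] ∑[ i < m ] 𝟙 (lookup p (combine i j))
∣p∣≡∑∑ m {n} p = trans (∣p∣≡∑ p) (trans (∑-combine m {n} _) (∑-comm {m} {n} _))

unique⇒∣p∣≤1 : ∀ {n} {p : Subset n} → (∀ {x y} → x ∈ p → y ∈ p → x ≡ y) → ∣ p ∣ ≤ 1
unique⇒∣p∣≤1 {p = []} _ = z≤n
unique⇒∣p∣≤1 {p = false ∷ p} unique =
  unique⇒∣p∣≤1 λ x∈p y∈p → suc-injective (unique (there x∈p) (there y∈p))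
unique⇒∣p∣≤1 {suc n} {p = true ∷ p} unique =
  s≤s (≤-reflexive (trans (cong ∣_∣ (Empty-unique λ (x , x∈p) → 0≢1+n (unique here (there x∈p))))
                          (∣⊥∣≡0 n)))

distinct⇒2≤∣p∣ : ∀ {n} {p : Subset n} {x y} → x ≢ y → x ∈ p → y ∈ p → 2 ≤ ∣ p ∣
distinct⇒2≤∣p∣ {p = p} {x} {y} x≢y x∈p y∈p =
  subst (_< ∣ p ∣) (∣⁅x⁆∣≡1 x) (p⊂q⇒∣p∣<∣q∣ (⁅x⁆⊆p , y , y∈p , x≢y⇒x∉⁅y⁆ (x≢y ∘ sym)))
  where
  ⁅x⁆⊆p : ⁅ x ⁆ ⊆ p
  ⁅x⁆⊆p z∈⁅x⁆ = subst (_∈ p) (sym (x∈⁅y⁆⇒x≡y x z∈⁅x⁆)) x∈p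

_⊆ᴱ_ : ∀ {v} → Graph v → Graph v → Set
H ⊆ᴱ G = ∀ x y → T (adj H x y) → T (adj G x y)

IsSymmetric : ∀ {v} → Graph v → Set
IsSymmetric G = ∀ x y → adj G x y ≡ adj G y x

IsLoopless : ∀ {v} → Graph v → Set
IsLoopless G = ∀ x → ¬ T (adj G x x)

module _ {v} {G : Graph v} where

  ∈N⁺ : ∀ {x y} → T (adj G x y) → y ∈ N G x
  ∈N⁺ {x} {y} t = lookup⇒[]= y (N G x) (trans (lookup∘tabulate (adj G x) y) (to T-≡ t))

  ∈N⁻ : ∀ {x y} → y ∈ N G x → T (adj G x y)
  ∈N⁻ {x} {y} y∈N = from T-≡ (trans (sym (lookup∘tabulate (adj G x) y)) ([]=⇒lookup y∈N))

  two-neighbours-in : ∀ {D x y z} → y ≢ z → T (adj G x y) → y ∈ D → T (adj G x z) → z ∈ D →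
                      2 ≤ ∣ N G x ∩ D ∣
  two-neighbours-in y≢z xy y∈D xz z∈D =
    distinct⇒2≤∣p∣ y≢z (x∈p∩q⁺ (∈N⁺ xy , y∈D)) (x∈p∩q⁺ (∈N⁺ xz , z∈D))

  at-most-one-neighbour-in⇒∈ : ∀ {D x} → Is2Dominating G D →
    (∀ {y z} → T (adj G x y) → y ∈ D → T (adj G x z) → z ∈ D → y ≡ z) → x ∈ D
  at-most-one-neighbour-in⇒∈ {D} {x} dom unique with x ∈? D
  ... | yes x∈D = x∈D
  ... | no x∉D = contradiction (≤-trans (dom x x∉D) (unique⇒∣p∣≤1 unique-in-N∩D)) λ { (s≤s ()) }
    where
    unique-in-N∩D : ∀ {y z} → y ∈ N G x ∩ D → z ∈ N G x ∩ D → y ≡ z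
    unique-in-N∩D y∈ z∈ with x∈p∩q⁻ (N G x) D y∈ | x∈p∩q⁻ (N G x) D z∈
    ... | y∈N , y∈D | z∈N , z∈D = unique (∈N⁻ y∈N) y∈D (∈N⁻ z∈N) z∈D

Is2Dominating-mono : ∀ {v} {H G : Graph v} {D} → H ⊆ᴱ G → Is2Dominating H D → Is2Dominating G D
Is2Dominating-mono {H = H} {G} {D} H⊆G dom x x∉D = ≤-trans (dom x x∉D) (p⊆q⇒∣p∣≤∣q∣ N∩D-mono)
  where
  N∩D-mono : N H x ∩ D ⊆ N G x ∩ D
  N∩D-mono y∈ with x∈p∩q⁻ (N H x) D y∈
  ... | y∈N , y∈D = x∈p∩q⁺ (∈N⁺ {G = G} (H⊆G x _ (∈N⁻ {G = H} y∈N)) , y∈D)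

countsEdge : ∀ {v} → Graph v → EdgeSet v → Fin v → Fin v → ℕ
countsEdge G B x y = 𝟙 ((toℕ x <ᵇ toℕ y) ∧ inB G B x y)

module _ {v} {G : Graph v} {B : EdgeSet v} where

  increases : ∀ {D₀} → Is2Dominating G D₀ → (∀ D → Is2Dominating (G ─ B) D → ∣ D₀ ∣ < ∣ D ∣) →
              Increases G B
  increases dom₀ larger k (_ , minimal) D dom = ≤-<-trans (minimal _ dom₀) (larger D dom)

  ¬increases : ∀ {k} → γ₂≡ G k → G ⊆ᴱ (G ─ B) → ¬ Increases G B
  ¬increases γ@((D , dom , refl) , _) G⊆G─B inc =
    <-irrefl refl (inc _ γ D (Is2Dominating-mono G⊆G─B dom))

  ─⊆ᴱ : (G ─ B) ⊆ᴱ G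
  ─⊆ᴱ _ _ t = proj₁ (to T-∧ t)

  ─-cuts : ∀ {x y} → T (B x y ∨ B y x) → ¬ T (adj (G ─ B) x y)
  ─-cuts b t = T-not⇒¬T (proj₂ (to T-∧ t)) b

  ∣B∣ₑ≡∑∑ : ∣ B ∣ₑ[ G ] ≡ ∑[ x < v ] ∑[ y < v ] countsEdge G B x y
  ∣B∣ₑ≡∑∑ = trans (sumᴸ-concatMap edges-from (List.allFin v))
             (trans (sumᴸ-map-tabulate (sumᴸ ∘ edges-from) id)
                    (sum-cong-≗ λ x → sumᴸ-map-tabulate (countsEdge G B x) id))
    where
    edges-from : Fin v → List ℕ
    edges-from x = map (countsEdge G B x) (List.allFin v)

  ∣B∣ₑ≡0⇒⊆ᴱ─ : IsSymmetric G → IsLoopless G → ∣ B ∣ₑ[ G ] ≡ 0 → G ⊆ᴱ (G ─ B)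
  ∣B∣ₑ≡0⇒⊆ᴱ─ symmetric loopless none x y xy =
    from T-∧ (xy , ¬T⇒T-not λ b → not-in-B x y (from T-∧ (xy , b)))
    where
    uncounted : ∀ x y → countsEdge G B x y ≡ 0
    uncounted x y = n≤0⇒n≡0 (subst (countsEdge G B x y ≤_) (trans (sym ∣B∣ₑ≡∑∑) none)
      (≤-trans (≤-∑ (countsEdge G B x) y) (≤-∑ (λ x → ∑[ y < v ] countsEdge G B x y) x)))
    ordered : ∀ {x y} → toℕ x < toℕ y → ¬ T (inB G B x y)
    ordered {x} {y} x<y b =
      contradiction (trans (sym (T⇒𝟙≡1 (from T-∧ (<⇒<ᵇ x<y , b)))) (uncounted x y)) λ ()
    not-in-B : ∀ x y → ¬ T (inB G B x y)
    not-in-B x y with <-cmp (toℕ x) (toℕ y)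
    ... | tri< x<y _ _ = ordered x<y
    ... | tri> _ _ y<x = ordered y<x ∘ subst T (cong₂ _∧_ (symmetric x y) (∨-comm (B x y) (B y x)))
    ... | tri≈ _ x≡y _ with toℕ-injective {i = x} {j = y} x≡y
    ...   | refl = loopless x ∘ proj₁ ∘ to T-∧

edge : ∀ {v} → Fin v → Fin v → EdgeSet v
edge a b x y = ⌊ x ≟ a ⌋ ∧ ⌊ y ≟ b ⌋

module _ {v} {G : Graph v} {a b : Fin v} where

  edge-endpoints : ∀ {x y} → T (edge a b x y) → x ≡ a × y ≡ b
  edge-endpoints {x} {y} t with x ≟ a | y ≟ b
  ... | yes x≡a | yes y≡b = x≡a , y≡b
  ... | yes _   | no _    = ⊥-elim t
  ... | no _    | _       = ⊥-elim t

  edge-self : T (edge a b a b)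
  edge-self with a ≟ a | b ≟ b
  ... | yes _ | yes _ = _
  ... | yes _ | no b≢b = b≢b refl
  ... | no a≢a | _ = a≢a refl

  ─edge-cutsʳ : ¬ T (adj (G ─ edge a b) a b)
  ─edge-cutsʳ = ─-cuts {G = G} {B = edge a b} (from T-∨ (inj₁ edge-self))

  ─edge-cutsˡ : ¬ T (adj (G ─ edge a b) b a)
  ─edge-cutsˡ = ─-cuts {G = G} {B = edge a b} (from T-∨ (inj₂ edge-self))

  ∣edge∣ₑ≡1 : toℕ a < toℕ b → T (adj G a b) → ∣ edge a b ∣ₑ[ G ] ≡ 1
  ∣edge∣ₑ≡1 a<b ab = begin
    ∣ edge a b ∣ₑ[ G ]               ≡⟨ ∣B∣ₑ≡∑∑ {G = G} {B = edge a b} ⟩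
    ∑[ x < v ] ∑[ y < v ] term x y  ≡⟨ ∑-δ (λ x → ∑[ y < v ] term x y) a
                                          (λ x x≢a → ∑-zero (λ y → off x y (x≢a ∘ proj₁))) ⟩
    ∑[ y < v ] term a y              ≡⟨ ∑-δ (term a) b (λ y y≢b → off a y (y≢b ∘ proj₂)) ⟩
    term a b                         ≡⟨ counted ⟩
    1                                ∎
    where
    open ≡-Reasoning
    term : Fin v → Fin v → ℕ
    term = countsEdge G (edge a b)
    counted : term a b ≡ 1
    counted = T⇒𝟙≡1 (from T-∧ (<⇒<ᵇ a<b , from T-∧ (ab , from T-∨ (inj₁ edge-self))))
    -- The reversed orientation (b , a) is excluded by the test x < y.
    support : ∀ {x y} → T ((toℕ x <ᵇ toℕ y) ∧ inB G (edge a b) x y) → x ≡ a × y ≡ b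
    support {x} {y} t with to (T-∧ {toℕ x <ᵇ toℕ y}) t
    ... | x<y , xy with to (T-∨ {edge a b x y}) (proj₂ (to (T-∧ {adj G x y}) xy))
    ...   | inj₁ x→y = edge-endpoints x→y
    ...   | inj₂ y→x with edge-endpoints {x = y} {y = x} y→x
    ...     | refl , refl = ⊥-elim (<-asym a<b (<ᵇ⇒< _ _ x<y))
    off : ∀ x y → ¬ (x ≡ a × y ≡ b) → term x y ≡ 0
    off x y ne = ¬T⇒𝟙≡0 (ne ∘ support)

Consecutive : ℕ → ℕ → Set
Consecutive a b = b ≡ suc a ⊎ a ≡ suc b

∣m-n∣≡1⇒consecutive : ∀ m n → ∣ m - n ∣ ≡ 1 → Consecutive m n
∣m-n∣≡1⇒consecutive zero (suc zero) _ = inj₁ refl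
∣m-n∣≡1⇒consecutive (suc zero) zero _ = inj₂ refl
∣m-n∣≡1⇒consecutive (suc m) (suc n) e = Sum.map (cong suc) (cong suc) (∣m-n∣≡1⇒consecutive m n e)
∣m-n∣≡1⇒consecutive zero zero ()
∣m-n∣≡1⇒consecutive zero (suc (suc n)) ()
∣m-n∣≡1⇒consecutive (suc (suc m)) zero ()

consecutive⇒∣m-n∣≡1 : ∀ {m n} → Consecutive m n → ∣ m - n ∣ ≡ 1
consecutive⇒∣m-n∣≡1 {zero} (inj₁ refl) = refl
consecutive⇒∣m-n∣≡1 {suc m} (inj₁ refl) = consecutive⇒∣m-n∣≡1 {m} (inj₁ refl)
consecutive⇒∣m-n∣≡1 {n = zero} (inj₂ refl) = refl
consecutive⇒∣m-n∣≡1 {n = suc n} (inj₂ refl) = consecutive⇒∣m-n∣≡1 {n = n} (inj₂ refl)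

UnitDistance : ℕ → ℕ → ℕ → ℕ → Set
UnitDistance a a' b b' = (a ≡ a' × Consecutive b b') ⊎ (Consecutive a a' × b ≡ b')

unit-distance⁻ : ∀ a a' b b' → T ((∣ a - a' ∣ + ∣ b - b' ∣) ≡ᵇ 1) → UnitDistance a a' b b'
unit-distance⁻ a a' b b' t with ∣ a - a' ∣ in dₐ | ≡ᵇ⇒≡ (∣ a - a' ∣ + ∣ b - b' ∣) 1 t
... | zero     | d = inj₁ (∣m-n∣≡0⇒m≡n dₐ , ∣m-n∣≡1⇒consecutive b b' d)
... | suc zero | d = inj₂ (∣m-n∣≡1⇒consecutive a a' dₐ , ∣m-n∣≡0⇒m≡n (ℕ.suc-injective d))

unit-distance⁺ : ∀ {a a' b b'} → UnitDistance a a' b b' → T ((∣ a - a' ∣ + ∣ b - b' ∣) ≡ᵇ 1)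
unit-distance⁺ {a} (inj₁ (refl , c)) rewrite ∣n-n∣≡0 a | consecutive⇒∣m-n∣≡1 c = _
unit-distance⁺ {b = b} (inj₂ (c , refl)) rewrite ∣n-n∣≡0 b | consecutive⇒∣m-n∣≡1 c = _

unitApart : ∀ {m n} → Fin m × Fin n → Fin m × Fin n → Bool
unitApart (i , j) (i' , j') = (∣ toℕ i - toℕ i' ∣ + ∣ toℕ j - toℕ j' ∣) ≡ᵇ 1

grid-remQuot : ∀ m n (x y : Fin (m * n)) →
               adj (grid m n) x y ≡ unitApart (remQuot {m} n x) (remQuot {m} n y)
grid-remQuot m n x y with remQuot {m} n x | remQuot {m} n y
... | _ , _ | _ , _ = refl

grid-combine : ∀ {m n} (i i' : Fin m) (j j' : Fin n) →
               adj (grid m n) (combine i j) (combine i' j') ≡ unitApart (i , j) (i' , j')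
grid-combine {m} {n} i i' j j' =
  trans (grid-remQuot m n _ _) (cong₂ unitApart (remQuot-combine i j) (remQuot-combine i' j'))

grid-symmetric : ∀ m n → IsSymmetric (grid m n)
grid-symmetric m n x y =
  trans (grid-remQuot m n x y)
        (trans (unitApart-sym (remQuot {m} n x) (remQuot {m} n y)) (sym (grid-remQuot m n y x)))
  where
  unitApart-sym : ∀ p q → unitApart {m} {n} p q ≡ unitApart q p
  unitApart-sym (i , j) (i' , j') rewrite ∣-∣-comm (toℕ i) (toℕ i') | ∣-∣-comm (toℕ j) (toℕ j') = refl

grid-loopless : ∀ m n → IsLoopless (grid m n)
grid-loopless m n x = unitApart-irrefl (remQuot {m} n x) ∘ subst T (grid-remQuot m n x x)
  where
  unitApart-irrefl : ∀ p → ¬ T (unitApart {m} {n} p p)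
  unitApart-irrefl (i , j) rewrite ∣n-n∣≡0 (toℕ i) | ∣n-n∣≡0 (toℕ j) = λ ()

isEven : ℕ → Bool
isEven zero = true
isEven (suc m) = not (isEven m)

isEven-consecutive : ∀ {a b} → Consecutive a b → isEven b ≡ not (isEven a)
isEven-consecutive (inj₁ refl) = refl
isEven-consecutive (inj₂ refl) = sym (not-involutive _)

module Ladder (k : ℕ) where

  n : ℕ
  n = suc (suc k)

  L : Graph (2 * n)
  L = grid 2 n

  cell : Fin 2 → Fin n → Fin (2 * n)
  cell = combine

  consecutive-rows : ∀ {i i' : Fin 2} → Consecutive (toℕ i) (toℕ i') → i' ≡ opposite i
  consecutive-rows {zero} {suc zero} _ = refl
  consecutive-rows {suc zero} {zero} _ = refl
  consecutive-rows {zero} {zero} (inj₁ ())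
  consecutive-rows {zero} {zero} (inj₂ ())
  consecutive-rows {suc zero} {suc zero} (inj₁ ())
  consecutive-rows {suc zero} {suc zero} (inj₂ ())

  rows-consecutive : ∀ (i : Fin 2) → Consecutive (toℕ i) (toℕ (opposite i))
  rows-consecutive zero = inj₁ refl
  rows-consecutive (suc zero) = inj₂ refl

  opposite≢ : ∀ (i : Fin 2) → opposite i ≢ i
  opposite≢ zero ()
  opposite≢ (suc zero) ()

  neighbour⁻ : ∀ i j i' j' → T (adj L (cell i j) (cell i' j')) →
               (i' ≡ i × Consecutive (toℕ j) (toℕ j')) ⊎ (i' ≡ opposite i × j' ≡ j)
  neighbour⁻ i j i' j' t
    with unit-distance⁻ (toℕ i) (toℕ i') (toℕ j) (toℕ j') (subst T (grid-combine i i' j j') t)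
  ... | inj₁ (i≡i' , c) = inj₁ (sym (toℕ-injective i≡i') , c)
  ... | inj₂ (c , j≡j') = inj₂ (consecutive-rows c , sym (toℕ-injective j≡j'))

  vertical : ∀ i j → T (adj L (cell i j) (cell (opposite i) j))
  vertical i j = subst T (sym (grid-combine i (opposite i) j j))
                         (unit-distance⁺ {b = toℕ j} (inj₂ (rows-consecutive i , refl)))

  horizontal : ∀ i {j j'} → Consecutive (toℕ j) (toℕ j') → T (adj L (cell i j) (cell i j'))
  horizontal i {j} {j'} c = subst T (sym (grid-combine i i j j')) (unit-distance⁺ {toℕ i} (inj₁ (refl , c)))

  column : Subset (2 * n) → Fin n → ℕ
  column D j = ∑[ i < 2 ] 𝟙 (lookup D (cell i j))

  ∣D∣≡∑column : ∀ D → ∣ D ∣ ≡ ∑[ j < n ] column D j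
  ∣D∣≡∑column = ∣p∣≡∑∑ 2

  ∈⇒1≤column : ∀ {D} i j → cell i j ∈ D → 1 ≤ column D j
  ∈⇒1≤column {D} i j i∈D =
    subst (λ b → 𝟙 b ≤ column D j) ([]=⇒lookup i∈D) (≤-∑ (λ i → 𝟙 (lookup D (cell i j))) i)

  column≡0⇒∉ : ∀ {D j} → column D j ≡ 0 → ∀ i → cell i j ∉ D
  column≡0⇒∉ {j = j} empty i i∈D with subst (1 ≤_) empty (∈⇒1≤column i j i∈D)
  ... | ()

  full-column : ∀ {D j} → cell zero j ∈ D → cell (suc zero) j ∈ D → column D j ≡ 2
  full-column top∈D bottom∈D rewrite []=⇒lookup top∈D | []=⇒lookup bottom∈D = refl

  module _ {D} (dom : Is2Dominating L D) where

    opposite∉∧right∉⇒∈ : ∀ i j → cell (opposite i) j ∉ D →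
                         (∀ j' → toℕ j' ≡ suc (toℕ j) → cell i j' ∉ D) → cell i j ∈ D
    opposite∉∧right∉⇒∈ i j opposite∉D right∉D = at-most-one-neighbour-in⇒∈ {G = L} dom unique
      where
      left : ∀ {y} → T (adj L (cell i j) y) → y ∈ D → ∃[ j' ] (y ≡ cell i j' × toℕ j ≡ suc (toℕ j'))
      left {y} t y∈D with combine-surjective {2} {n} y
      ... | i' , j' , refl with neighbour⁻ i j i' j' t
      ... | inj₁ (refl , inj₁ right) = contradiction y∈D (right∉D j' right)
      ... | inj₁ (refl , inj₂ l) = j' , refl , l
      ... | inj₂ (refl , refl) = contradiction y∈D opposite∉D
      unique : ∀ {y z} → T (adj L (cell i j) y) → y ∈ D → T (adj L (cell i j) z) → z ∈ D → y ≡ z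
      unique ty y∈D tz z∈D with left ty y∈D | left tz z∈D
      ... | j₁ , refl , e₁ | j₂ , refl , e₂ =
        cong (cell i) (toℕ-injective (ℕ.suc-injective (trans (sym e₁) e₂)))

    last-column-occupied : 1 ≤ column D (fromℕ (suc k))
    last-column-occupied with column D (fromℕ (suc k)) in empty
    ... | suc _ = s≤s z≤n
    ... | zero = contradiction
                   (opposite∉∧right∉⇒∈ zero (fromℕ (suc k)) (column≡0⇒∉ empty (suc zero)) beyond)
                   (column≡0⇒∉ empty zero)
      where
      beyond : ∀ j' → toℕ j' ≡ suc (toℕ (fromℕ (suc k))) → cell zero j' ∉ D
      beyond j' e _ = <-irrefl (trans e (cong suc (toℕ-fromℕ (suc k)))) (toℕ<n j')

    empty-column⇒full-next : ZerosFollowedByTwos (column D)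
    empty-column⇒full-next j empty = full-column (right∈D zero) (right∈D (suc zero))
      where
      right∈D : ∀ i → cell i (suc j) ∈ D
      right∈D i with cell i (suc j) ∈? D
      ... | yes ∈D = ∈D
      ... | no ∉D = contradiction
                      (opposite∉∧right∉⇒∈ i (inject₁ j) (column≡0⇒∉ empty (opposite i)) right∉D)
                      (column≡0⇒∉ empty i)
        where
        right∉D : ∀ j' → toℕ j' ≡ suc (toℕ (inject₁ j)) → cell i j' ∉ D
        right∉D j' e = subst (λ j'' → cell i j'' ∉ D)
                              (sym (toℕ-injective (trans e (cong suc (toℕ-inject₁ j))))) ∉D

    n≤∣D∣ : n ≤ ∣ D ∣
    n≤∣D∣ = subst (n ≤_) (sym (∣D∣≡∑column D))
                  (length≤∑ (column D) empty-column⇒full-next last-column-occupied)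

    full-first-column⇒n<∣D∣ : 2 ≤ column D zero → n < ∣ D ∣
    full-first-column⇒n<∣D∣ full =
      subst (n <_) (sym (∣D∣≡∑column D))
            (length<∑ (column D) empty-column⇒full-next last-column-occupied full)

  checker : Fin 2 → Fin n → Bool
  checker zero j = isEven (toℕ j)
  checker (suc zero) j = not (isEven (toℕ j))

  checkerboard : Subset (2 * n)
  checkerboard = tabulate (uncurry checker ∘ remQuot {2} n)

  lookup-checkerboard : ∀ i j → lookup checkerboard (cell i j) ≡ checker i j
  lookup-checkerboard i j =
    trans (lookup∘tabulate (uncurry checker ∘ remQuot {2} n) (cell i j))
          (cong (uncurry checker) (remQuot-combine i j))

  checker-opposite : ∀ i j → checker (opposite i) j ≡ not (checker i j)
  checker-opposite zero j = refl
  checker-opposite (suc zero) j = sym (not-involutive _)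

  checker-consecutive : ∀ i j j' → Consecutive (toℕ j) (toℕ j') → checker i j' ≡ not (checker i j)
  checker-consecutive zero j j' c = isEven-consecutive c
  checker-consecutive (suc zero) j j' c = cong not (isEven-consecutive c)

  consecutive-column : ∀ (j : Fin n) → Σ[ j' ∈ Fin n ] Consecutive (toℕ j) (toℕ j')
  consecutive-column zero = suc zero , inj₁ refl
  consecutive-column (suc j) = inject₁ j , inj₂ (cong suc (sym (toℕ-inject₁ j)))

  ∣checkerboard∣≡n : ∣ checkerboard ∣ ≡ n
  ∣checkerboard∣≡n = trans (∣D∣≡∑column checkerboard) (trans (sum-cong-≗ column≡1) (∑-1 n))
    where
    column≡1 : ∀ j → column checkerboard j ≡ 1
    column≡1 j rewrite lookup-checkerboard zero j | lookup-checkerboard (suc zero) j with isEven (toℕ j)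
    ... | true = refl
    ... | false = refl

  checkerboard-2-dominating : Is2Dominating L checkerboard
  checkerboard-2-dominating x x∉D with combine-surjective {2} {n} x
  ... | i , j , refl with consecutive-column j
  ... | j' , c = two-neighbours-in {G = L} {x = cell i j}
                   (opposite≢ i ∘ combine-injectiveˡ (opposite i) j i j')
                   (vertical i j) (∈checkerboard (opposite i) j (checker-opposite i j))
                   (horizontal i {j} {j'} c) (∈checkerboard i j' (checker-consecutive i j j' c))
    where
    checker≡false : checker i j ≡ false
    checker≡false with checker i j in e
    ... | true = contradiction (lookup⇒[]= (cell i j) checkerboard (trans (lookup-checkerboard i j) e)) x∉D
    ... | false = refl
    ∈checkerboard : ∀ i' j' → checker i' j' ≡ not (checker i j) → cell i' j' ∈ checkerboard
    ∈checkerboard i' j' e = lookup⇒[]= (cell i' j') checkerboard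
                              (trans (lookup-checkerboard i' j') (trans e (cong not checker≡false)))

  γ₂-ladder : γ₂≡ L n
  γ₂-ladder = (checkerboard , checkerboard-2-dominating , ∣checkerboard∣≡n) , λ D dom → n≤∣D∣ dom

  rung : EdgeSet (2 * n)
  rung = edge (cell zero zero) (cell (suc zero) zero)

  rung-cut : ∀ i → ¬ T (adj (L ─ rung) (cell i zero) (cell (opposite i) zero))
  rung-cut zero = ─edge-cutsʳ {G = L} {cell zero zero} {cell (suc zero) zero}
  rung-cut (suc zero) = ─edge-cutsˡ {G = L} {cell zero zero} {cell (suc zero) zero}

  corner∈ : ∀ {D} → Is2Dominating (L ─ rung) D → ∀ i → cell i zero ∈ D
  corner∈ dom i =
    at-most-one-neighbour-in⇒∈ {G = L ─ rung} dom λ ty _ tz _ → trans (only ty) (sym (only tz))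
    where
    only : ∀ {y} → T (adj (L ─ rung) (cell i zero) y) → y ≡ cell i (suc zero)
    only {y} t with combine-surjective {2} {n} y
    ... | i' , j' , refl
      with neighbour⁻ i zero i' j' (─⊆ᴱ {G = L} {B = rung} (cell i zero) (cell i' j') t)
    ... | inj₁ (refl , inj₁ j'≡1) = cong (cell i) (toℕ-injective j'≡1)
    ... | inj₁ (refl , inj₂ ())
    ... | inj₂ (refl , refl) = contradiction t (rung-cut i)

  first-column-full : ∀ {D} → Is2Dominating (L ─ rung) D → 2 ≤ column D zero
  first-column-full {D} dom = ≤-reflexive (sym (full-column {D} (corner∈ dom zero) (corner∈ dom (suc zero))))

  rung-increases : Increases L rung
  rung-increases = increases {G = L} {B = rung} checkerboard-2-dominating λ D dom →
    subst (_< ∣ D ∣) (sym ∣checkerboard∣≡n)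
          (full-first-column⇒n<∣D∣ (Is2Dominating-mono (─⊆ᴱ {G = L} {B = rung}) dom) (first-column-full dom))

  ∣rung∣≡1 : ∣ rung ∣ₑ[ L ] ≡ 1
  ∣rung∣≡1 = ∣edge∣ₑ≡1 {G = L} {cell zero zero} {cell (suc zero) zero} z<s (vertical zero zero)

  increasing⇒1≤∣B∣ₑ : ∀ B → Increases L B → 1 ≤ ∣ B ∣ₑ[ L ]
  increasing⇒1≤∣B∣ₑ B inc with ∣ B ∣ₑ[ L ] in none
  ... | suc _ = s≤s z≤n
  ... | zero = contradiction inc (¬increases {B = B} γ₂-ladder L⊆L─B)
    where
    L⊆L─B : L ⊆ᴱ (L ─ B)
    L⊆L─B = ∣B∣ₑ≡0⇒⊆ᴱ─ {B = B} (grid-symmetric 2 n) (grid-loopless 2 n) none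

  b₂-ladder : b₂≡ L 1
  b₂-ladder = (rung , rung-increases , ∣rung∣≡1) , increasing⇒1≤∣B∣ₑ

theorem1 : (n : ℕ) → 2 ≤ n → γ₂≡ (grid 2 n) n × b₂≡ (grid 2 n) 1
theorem1 (suc (suc k)) _ = Ladder.γ₂-ladder k , Ladder.b₂-ladder k
theorem1 (suc zero) (s≤s ())
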